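{- For any graph $G$ with no isolated vertex, order $n$ and maximum degree $\Delta$, $$\left\lceil\frac{2n}{\Delta}\right\rceil\le\gamma_{(2,2,2)}(G)\le 2\gamma_t(G).$$ Furthermore, if $G$ has minimum degree $\delta\ge2$, then $\gamma_{(2,2,2)}(G)\le\gamma_{\times2,t}(G)$.
   Context: All graphs are finite and simple; $N(v)$ is the open neighbourhood and $f(S)=\sum_{u\in S}f(u)$. $\gamma_{(2,2,2)}(G)$ is the minimum of $\sum_v f(v)$ over functions $f:V(G)\to\{0,1,2\}$ with $f(N(v))\ge 2$ for every vertex $v$. $\gamma_t(G)$ is the total domination number (minimum size of a set $D$ such that every vertex has a neighbour in $D$). $\gamma_{\times2,t}(G)$ is the double total domination number (minimum size of a set $D$ such that every vertex has at least two neighbours in $D$), defined when $\delta\ge2$. -}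

module Defs where

open import Data.Nat using (ℕ; zero; suc; _+_; _*_; _∸_; _≤_; _<_; _⊔_; NonZero)
open import Data.Nat.Base using (_/_)
open import Data.Fin using (Fin)
open import Data.Bool using (Bool; true; false; if_then_else_)
open import Data.Product using (Σ; _×_)
open import Relation.Binary.PropositionalEquality using (_≡_)
open import Relation.Nullary using (¬_)

Σ[_] : {n : ℕ} → (Fin n → ℕ) → ℕ
Σ[_] {zero}  f = 0
Σ[_] {suc n} f = f Fin.zero + Σ[_] {n} (λ i → f (Fin.suc i))

Max[_] : {n : ℕ} → (Fin n → ℕ) → ℕ
Max[_] {zero}  f = 0
Max[_] {suc n} f = f Fin.zero ⊔ Max[_] {n} (λ i → f (Fin.suc i))

record Graph (n : ℕ) : Set where
  field
    adj       : Fin n → Fin n → Bool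
    symmetric : ∀ u v → adj u v ≡ adj v u
    irreflexive : ∀ v → adj v v ≡ false
open Graph public

weightN : {n : ℕ} → Graph n → (Fin n → ℕ) → Fin n → ℕ
weightN G f v = Σ[ (λ u → if adj G v u then f u else 0) ]

ind : {n : ℕ} → (Fin n → Bool) → Fin n → ℕ
ind D u = if D u then 1 else 0

deg : {n : ℕ} → Graph n → Fin n → ℕ
deg G v = weightN G (λ _ → 1) v

maxDeg : {n : ℕ} → Graph n → ℕ
maxDeg G = Max[ deg G ]

NoIsolated : {n : ℕ} → Graph n → Set
NoIsolated G = ∀ v → ¬ (deg G v ≡ 0)

MinDegAtLeast : {n : ℕ} → Graph n → ℕ → Set
MinDegAtLeast G k = ∀ v → k ≤ deg G v

size : {n : ℕ} → (Fin n → Bool) → ℕ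
size D = Σ[ ind D ]

Is222DomFun : {n : ℕ} → Graph n → (Fin n → ℕ) → Set
Is222DomFun G f = (∀ v → f v ≤ 2) × (∀ v → 2 ≤ weightN G f v)

IsTDS : {n : ℕ} → Graph n → (Fin n → Bool) → Set
IsTDS G D = ∀ v → 1 ≤ weightN G (ind D) v

IsDTDS : {n : ℕ} → Graph n → (Fin n → Bool) → Set
IsDTDS G D = ∀ v → 2 ≤ weightN G (ind D) v

Is-γ222 : {n : ℕ} → Graph n → ℕ → Set
Is-γ222 G k = Σ (Fin _ → ℕ) (λ f → Is222DomFun G f × Σ[ f ] ≡ k)
            × (∀ f → Is222DomFun G f → k ≤ Σ[ f ])

Is-γt : {n : ℕ} → Graph n → ℕ → Set
Is-γt G k = Σ (Fin _ → Bool) (λ D → IsTDS G D × size D ≡ k)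
          × (∀ D → IsTDS G D → k ≤ size D)

Is-γ×2t : {n : ℕ} → Graph n → ℕ → Set
Is-γ×2t G k = Σ (Fin _ → Bool) (λ D → IsDTDS G D × size D ≡ k)
            × (∀ D → IsDTDS G D → k ≤ size D)

-- ceiling division ⌈a / b⌉; only used with b ≠ 0 (b = 0 gives junk value 0)
⌈_/_⌉ : ℕ → ℕ → ℕ
⌈ a / zero ⌉ = 0
⌈ a / suc b ⌉ = (a + b) / suc b

-- Summing the constraints f(N(v)) ≥ 2 over all n vertices counts every value f(u)
-- exactly deg(u) ≤ Δ times, so 2n ≤ Δ · w(f) for every (2,2,2)-dominating function f.
-- Conversely, twice the indicator of a total dominating set and the indicator of a
-- double total dominating set are (2,2,2)-dominating functions.
module Submission where

open import Defs
open import Data.Nat using (ℕ; zero; suc; _+_; _*_; _≤_; _<_; z≤n; s≤s)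
open import Data.Nat.Properties
open import Data.Nat.DivMod using (m<n*o⇒m/o<n)
open import Data.Fin using (Fin)
open import Data.Bool using (Bool; true; false; if_then_else_)
open import Data.Product using (_×_; _,_)
open import Relation.Binary.PropositionalEquality
open import Algebra.Properties.CommutativeSemigroup +-commutativeSemigroup using (interchange)

Σ-cong : ∀ {n} {f g : Fin n → ℕ} → (∀ i → f i ≡ g i) → Σ[ f ] ≡ Σ[ g ]
Σ-cong {zero}  e = refl
Σ-cong {suc n} e = cong₂ _+_ (e Fin.zero) (Σ-cong {n} (λ i → e (Fin.suc i)))

Σ-mono-≤ : ∀ {n} {f g : Fin n → ℕ} → (∀ i → f i ≤ g i) → Σ[ f ] ≤ Σ[ g ]
Σ-mono-≤ {zero}  e = z≤n
Σ-mono-≤ {suc n} e = +-mono-≤ (e Fin.zero) (Σ-mono-≤ {n} (λ i → e (Fin.suc i)))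

Σ-const-≤ : ∀ {n} (c : ℕ) {f : Fin n → ℕ} → (∀ i → c ≤ f i) → n * c ≤ Σ[ f ]
Σ-const-≤ {zero}  c e = z≤n
Σ-const-≤ {suc n} c e = +-mono-≤ (e Fin.zero) (Σ-const-≤ {n} c (λ i → e (Fin.suc i)))

Σ-zero : ∀ {n} → Σ[ (λ (_ : Fin n) → 0) ] ≡ 0
Σ-zero {zero}  = refl
Σ-zero {suc n} = Σ-zero {n}

Σ-+ : ∀ {n} (f g : Fin n → ℕ) → Σ[ (λ i → f i + g i) ] ≡ Σ[ f ] + Σ[ g ]
Σ-+ {zero}  f g = refl
Σ-+ {suc n} f g = begin
  (f Fin.zero + g Fin.zero) + Σ[ (λ i → f (Fin.suc i) + g (Fin.suc i)) ]
    ≡⟨ cong (f Fin.zero + g Fin.zero +_) (Σ-+ {n} _ _) ⟩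
  (f Fin.zero + g Fin.zero) + (Σ[ (λ i → f (Fin.suc i)) ] + Σ[ (λ i → g (Fin.suc i)) ])
    ≡⟨ interchange (f Fin.zero) (g Fin.zero) _ _ ⟩
  (f Fin.zero + Σ[ (λ i → f (Fin.suc i)) ]) + (g Fin.zero + Σ[ (λ i → g (Fin.suc i)) ])
    ∎
  where open ≡-Reasoning

Σ-*ˡ : ∀ {n} (c : ℕ) (f : Fin n → ℕ) → Σ[ (λ i → c * f i) ] ≡ c * Σ[ f ]
Σ-*ˡ {zero}  c f = sym (*-zeroʳ c)
Σ-*ˡ {suc n} c f = trans (cong (c * f Fin.zero +_) (Σ-*ˡ {n} c _))
                         (sym (*-distribˡ-+ c (f Fin.zero) _))

Σ-swap : ∀ {n m} (h : Fin n → Fin m → ℕ) →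
         Σ[ (λ i → Σ[ (λ j → h i j) ]) ] ≡ Σ[ (λ j → Σ[ (λ i → h i j) ]) ]
Σ-swap {zero}  {m} h = sym (Σ-zero {m})
Σ-swap {suc n} {m} h =
  trans (cong (Σ[ (λ j → h Fin.zero j) ] +_) (Σ-swap {n} (λ i j → h (Fin.suc i) j)))
        (sym (Σ-+ {m} (λ j → h Fin.zero j) (λ j → Σ[ (λ i → h (Fin.suc i) j) ])))

≤-Max : ∀ {n} (f : Fin n → ℕ) i → f i ≤ Max[ f ]
≤-Max {suc n} f Fin.zero    = m≤m⊔n _ _
≤-Max {suc n} f (Fin.suc i) = ≤-trans (≤-Max {n} _ i) (m≤n⊔m _ _)

⌈/⌉-least : ∀ a b g → a ≤ g * b → ⌈ a / b ⌉ ≤ g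
⌈/⌉-least a zero    g _   = z≤n
⌈/⌉-least a (suc b) g a≤g*b = <⇒≤pred (m<n*o⇒m/o<n {a + b} {suc g} lt)
  where
  lt : a + b < suc g * suc b
  lt = ≤-trans (s≤s (+-monoˡ-≤ b a≤g*b)) (≤-reflexive (cong suc (+-comm (g * suc b) b)))

ind≤1 : ∀ {n} (D : Fin n → Bool) v → ind D v ≤ 1
ind≤1 D v with D v
... | true  = ≤-refl
... | false = z≤n

if-*ˡ : ∀ c b x → (if b then c * x else 0) ≡ c * (if b then x else 0)
if-*ˡ c true  x = refl
if-*ˡ c false x = sym (*-zeroʳ c)

if-0≡*ind : ∀ b x → (if b then x else 0) ≡ x * (if b then 1 else 0)
if-0≡*ind true  x = sym (*-identityʳ x)
if-0≡*ind false x = sym (*-zeroʳ x)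

weightN-*ˡ : ∀ {n} (G : Graph n) c f v → weightN G (λ u → c * f u) v ≡ c * weightN G f v
weightN-*ˡ {n} G c f v =
  trans (Σ-cong {n} (λ u → if-*ˡ c (adj G v u) (f u)))
        (Σ-*ˡ {n} c (λ u → if adj G v u then f u else 0))

Σ-weightN≡Σ-*deg : ∀ {n} (G : Graph n) f → Σ[ weightN G f ] ≡ Σ[ (λ u → f u * deg G u) ]
Σ-weightN≡Σ-*deg {n} G f = begin
  Σ[ (λ v → Σ[ (λ u → if adj G v u then f u else 0) ]) ]
    ≡⟨ Σ-swap {n} (λ v u → if adj G v u then f u else 0) ⟩
  Σ[ (λ u → Σ[ (λ v → if adj G v u then f u else 0) ]) ]
    ≡⟨ Σ-cong {n} (λ u → Σ-cong {n} (λ v → cong (λ b → if b then f u else 0) (symmetric G v u))) ⟩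
  Σ[ (λ u → Σ[ (λ v → if adj G u v then f u else 0) ]) ]
    ≡⟨ Σ-cong {n} (λ u → Σ-cong {n} (λ v → if-0≡*ind (adj G u v) (f u))) ⟩
  Σ[ (λ u → Σ[ (λ v → f u * (if adj G u v then 1 else 0)) ]) ]
    ≡⟨ Σ-cong {n} (λ u → Σ-*ˡ {n} (f u) _) ⟩
  Σ[ (λ u → f u * deg G u) ]
    ∎
  where open ≡-Reasoning

Σ-weightN≤Σ*maxDeg : ∀ {n} (G : Graph n) f → Σ[ weightN G f ] ≤ Σ[ f ] * maxDeg G
Σ-weightN≤Σ*maxDeg {n} G f = begin
  Σ[ weightN G f ]                  ≡⟨ Σ-weightN≡Σ-*deg G f ⟩
  Σ[ (λ u → f u * deg G u) ]        ≤⟨ Σ-mono-≤ {n} (λ u → *-monoʳ-≤ (f u) (≤-Max (deg G) u)) ⟩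
  Σ[ (λ u → f u * maxDeg G) ]       ≡⟨ Σ-cong {n} (λ u → *-comm (f u) (maxDeg G)) ⟩
  Σ[ (λ u → maxDeg G * f u) ]       ≡⟨ Σ-*ˡ {n} (maxDeg G) f ⟩
  maxDeg G * Σ[ f ]                 ≡⟨ *-comm (maxDeg G) Σ[ f ] ⟩
  Σ[ f ] * maxDeg G                 ∎
  where open ≤-Reasoning

Is222DomFun⇒2n≤Σ*maxDeg : ∀ {n} (G : Graph n) {f} → Is222DomFun G f → 2 * n ≤ Σ[ f ] * maxDeg G
Is222DomFun⇒2n≤Σ*maxDeg {n} G {f} (_ , dom) = begin
  2 * n                   ≡⟨ *-comm 2 n ⟩
  n * 2                   ≤⟨ Σ-const-≤ 2 dom ⟩
  Σ[ weightN G f ]        ≤⟨ Σ-weightN≤Σ*maxDeg G f ⟩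
  Σ[ f ] * maxDeg G       ∎
  where open ≤-Reasoning

IsTDS⇒Is222DomFun : ∀ {n} (G : Graph n) {D} → IsTDS G D → Is222DomFun G (λ u → 2 * ind D u)
IsTDS⇒Is222DomFun G {D} tds =
    (λ v → *-monoʳ-≤ 2 (ind≤1 D v))
  , (λ v → ≤-trans (*-monoʳ-≤ 2 (tds v)) (≤-reflexive (sym (weightN-*ˡ G 2 (ind D) v))))

IsDTDS⇒Is222DomFun : ∀ {n} (G : Graph n) {D} → IsDTDS G D → Is222DomFun G (ind D)
IsDTDS⇒Is222DomFun G {D} dtds = (λ v → ≤-trans (ind≤1 D v) (n≤1+n 1)) , dtds

-- The hypotheses on isolated vertices and minimum degree only guarantee that the
-- optimal sets exist; here these are given.
theorem3p12 : ∀ {n : ℕ} (G : Graph n) → NoIsolated G → 0 < n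
    → ∀ (g t : ℕ) → Is-γ222 G g → Is-γt G t
    → (⌈ 2 * n / maxDeg G ⌉ ≤ g × g ≤ 2 * t)
      × (MinDegAtLeast G 2 → ∀ (d : ℕ) → Is-γ×2t G d → g ≤ d)
theorem3p12 {n} G _ _ g t ((f , f-dom , Σf≡g) , g-least) ((D , D-tds , |D|≡t) , _) =
  (lower , upper-γt) , upper-γ×2t
  where
  lower : ⌈ 2 * n / maxDeg G ⌉ ≤ g
  lower = ⌈/⌉-least (2 * n) (maxDeg G) g
    (subst (λ w → 2 * n ≤ w * maxDeg G) Σf≡g (Is222DomFun⇒2n≤Σ*maxDeg G f-dom))

  upper-γt : g ≤ 2 * t
  upper-γt = ≤-trans (g-least _ (IsTDS⇒Is222DomFun G D-tds))
    (≤-reflexive (trans (Σ-*ˡ {n} 2 (ind D)) (cong (2 *_) |D|≡t)))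

  upper-γ×2t : MinDegAtLeast G 2 → ∀ (d : ℕ) → Is-γ×2t G d → g ≤ d
  upper-γ×2t _ d ((E , E-dtds , |E|≡d) , _) =
    ≤-trans (g-least (ind E) (IsDTDS⇒Is222DomFun G E-dtds)) (≤-reflexive |E|≡d)
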